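{- The $\mathbb{Q}$-vector space $\mathfrak{B}$ is a subring of the field of Laurent series $\mathbb{Q}((T))$.
   Context: Let $e^T=\sum_{i\ge 0}T^i/i!\in\mathbb{Q}[[T]]$ and $\mathbf{B}=\mathbf{B}(T)=T/(e^T-1)\in\mathbb{Q}[[T]]$; for $b\in\mathbb{Q}$, $\mathbf{B}(bT)$ denotes the power series obtained by substituting $bT$ for $T$, and $\mathbf{B}^n(bT)=(\mathbf{B}(bT))^n$. Define $\mathfrak{B}$ to be the $\mathbb{Q}$-vector subspace of $\mathbb{Q}((T))$ spanned by all Laurent series $T^m\mathbf{B}^n(bT)e^{aT}$ with $m\in\mathbb{Z}$, $n$ a non-negative integer, $a\in\mathbb{Q}$ and $0\ne b\in\mathbb{Q}$. -}

module Defs where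

open import Data.Nat as ℕ using (ℕ; zero; suc; _!)
open import Data.Nat.Properties using (_!≢0)
open import Data.Integer as ℤ using (ℤ; +_)
open import Data.Rational as ℚ using (ℚ; 0ℚ; 1ℚ)
open import Data.List using (List; []; _∷_; foldr; map; zipWith; upTo)
open import Data.List.Relation.Unary.All using (All)
open import Data.Product using (_×_; _,_; ∃)
open import Relation.Binary.PropositionalEquality using (_≡_; _≢_)

-- Formal power series over ℚ: coefficient functions ℕ → ℚ
-- (f represents Σ_i f i T^i).

PS : Set
PS = ℕ → ℚ

pow : ℚ → ℕ → ℚ
pow q zero    = 1ℚ
pow q (suc n) = q ℚ.* pow q n

sumTo : (ℕ → ℚ) → ℕ → ℚ
sumTo f zero    = f zero
sumTo f (suc n) = sumTo f n ℚ.+ f (suc n)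

_*PS_ : PS → PS → PS
(f *PS g) n = sumTo (λ i → f i ℚ.* g (n ℕ.∸ i)) n

onePS : PS
onePS zero    = 1ℚ
onePS (suc _) = 0ℚ

powPS : PS → ℕ → PS
powPS f zero    = onePS
powPS f (suc n) = f *PS powPS f n

-- Multiplicative inverse of a power series f with constant term 1
-- (the hypothesis f 0 = 1 is not checked; only used below for such f).
-- invList f n = [g n , g (n-1) , … , g 0] where g = f⁻¹, via
-- g 0 = 1,  g n = - Σ_{i=1}^{n} f i * g (n - i).
invList : PS → ℕ → List ℚ
invList f zero    = 1ℚ ∷ []
invList f (suc n) =
  ℚ.- foldr ℚ._+_ 0ℚ (zipWith ℚ._*_ (map (λ i → f (suc i)) (upTo (suc n))) (invList f n))
  ∷ invList f n

headOr0 : List ℚ → ℚ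
headOr0 []      = 0ℚ
headOr0 (x ∷ _) = x

inv1PS : PS → PS
inv1PS f n = headOr0 (invList f n)

expPS : ℚ → PS
expPS a i = pow a i ℚ.* ((+ 1 ℚ./ (i !)) {{i !≢0}})

-- (e^T - 1)/T = Σ T^i / (i+1)!
expm1divT : PS
expm1divT i = (+ 1 ℚ./ (suc i !)) {{suc i !≢0}}

-- 𝐁(T) = T/(e^T - 1), the inverse of (e^T - 1)/T in ℚ[[T]]
Bser : PS
Bser = inv1PS expm1divT

substPS : ℚ → PS → PS
substPS b f i = pow b i ℚ.* f i

-- Laurent series over ℚ: a pair (v , f) represents T^v · Σ_i f i T^i.

record Laurent : Set where
  constructor laurent
  field
    val   : ℤ
    coeff : PS
open Laurent public

coefL : Laurent → ℤ → ℚ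
coefL (laurent v f) k with k ℤ.- v
... | + j      = f j
... | ℤ.-[1+ _ ] = 0ℚ

infix 4 _≈L_
_≈L_ : Laurent → Laurent → Set
x ≈L y = ∀ k → coefL x k ≡ coefL y k

0L : Laurent
0L = laurent (+ 0) (λ _ → 0ℚ)

1L : Laurent
1L = laurent (+ 0) onePS

_+L_ : Laurent → Laurent → Laurent
x +L y = laurent m (λ i → coefL x (m ℤ.+ + i) ℚ.+ coefL y (m ℤ.+ + i))
  where m = val x ℤ.⊓ val y

-L_ : Laurent → Laurent
-L (laurent v f) = laurent v (λ i → ℚ.- f i)

_*L_ : Laurent → Laurent → Laurent
laurent v f *L laurent w g = laurent (v ℤ.+ w) (f *PS g)

_·L_ : ℚ → Laurent → Laurent
c ·L laurent v f = laurent v (λ i → c ℚ.* f i)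

gen : ℤ → ℕ → ℚ → ℚ → Laurent
gen m n a b = laurent m (powPS (substPS b Bser) n *PS expPS a)

-- a term (c , m , n , a , b) stands for c · T^m 𝐁^n(bT) e^{aT}
Term : Set
Term = ℚ × ℤ × ℕ × ℚ × ℚ

termL : Term → Laurent
termL (c , m , n , a , b) = c ·L gen m n a b

bNonZero : Term → Set
bNonZero (_ , _ , _ , _ , b) = b ≢ 0ℚ

linComb : List Term → Laurent
linComb ts = foldr _+L_ 0L (map termL ts)

In𝔅 : Laurent → Set
In𝔅 x = ∃ λ (ts : List Term) → All bNonZero ts × (x ≈L linComb ts)

module Submission where

-- Closure under 1, sums and negatives is immediate from the definition of 𝔅
-- as a span.  For products, write every element of 𝔅 as T^M F with F in the
-- span 𝔖 ⊆ ℚ[[T]] of the power series c T^j 𝐁^n(bT) e^{aT} (j ≥ 0, b ≠ 0);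
-- it then suffices that 𝔖 is closed under products.  For generators with the
-- same scale b this follows from e^{aT} e^{a'T} = e^{(a+a')T}.  For different
-- scales b, b' choose a common multiple d = ±k b = ±k' b' and use the
-- multiplication formula 𝐁(bT) = (1/k) 𝐁(kbT) Σ_{i<k} e^{ibT} and the
-- reflection formula 𝐁(-bT) = 𝐁(bT) e^{bT}: both generators lie in the span
-- of the terms with scale d, which is closed under products.

open import Defs
open import Data.Product using (_×_; _,_)

module Numerals where
  open import Data.Nat as ℕ using (ℕ; suc; _!)
  open import Data.Nat.Properties using (_!≢0)
  open import Data.Integer as ℤ using (+_)
  import Data.Integer.Properties as ℤP
  open import Data.Integer.Solver using (module +-*-Solver)
  open import Data.Rational as ℚ using (ℚ; 0ℚ; 1ℚ; _+_; _*_; fromℚᵘ)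
  open import Data.Rational.Properties
  open import Data.Rational.Solver renaming (module +-*-Solver to ℚ-Solver)
  import Data.Rational.Unnormalised as U
  import Data.Rational.Unnormalised.Properties as UP
  open import Relation.Binary.PropositionalEquality

  ⟦_⟧ : ℕ → ℚ
  ⟦ n ⟧ = + n ℚ./ 1

  -- Normalisation ℚᵘ → ℚ is a ring homomorphism; this reduces arithmetic
  -- facts about ⟦_⟧ and ℚ./ to integer identities.
  fromℚᵘ-homo-+ : ∀ x y → fromℚᵘ x + fromℚᵘ y ≡ fromℚᵘ (x U.+ y)
  fromℚᵘ-homo-+ x y = toℚᵘ-injective (UP.≃-trans (toℚᵘ-homo-+ (fromℚᵘ x) (fromℚᵘ y))
    (UP.≃-trans (UP.+-cong (toℚᵘ-fromℚᵘ x) (toℚᵘ-fromℚᵘ y)) (UP.≃-sym (toℚᵘ-fromℚᵘ (x U.+ y)))))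

  fromℚᵘ-homo-* : ∀ x y → fromℚᵘ x * fromℚᵘ y ≡ fromℚᵘ (x U.* y)
  fromℚᵘ-homo-* x y = toℚᵘ-injective (UP.≃-trans (toℚᵘ-homo-* (fromℚᵘ x) (fromℚᵘ y))
    (UP.≃-trans (UP.*-cong (toℚᵘ-fromℚᵘ x) (toℚᵘ-fromℚᵘ y)) (UP.≃-sym (toℚᵘ-fromℚᵘ (x U.* y)))))

  ⟦+⟧ : ∀ m n → ⟦ m ℕ.+ n ⟧ ≡ ⟦ m ⟧ + ⟦ n ⟧
  ⟦+⟧ m n = sym (trans (fromℚᵘ-homo-+ (U.mkℚᵘ (+ m) 0) (U.mkℚᵘ (+ n) 0))
    (fromℚᵘ-cong {U.mkℚᵘ (+ m) 0 U.+ U.mkℚᵘ (+ n) 0} {U.mkℚᵘ (+ (m ℕ.+ n)) 0} (U.*≡* eq)))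
    where
    open +-*-Solver
    eq : (+ m ℤ.* + 1 ℤ.+ + n ℤ.* + 1) ℤ.* + 1 ≡ + (m ℕ.+ n) ℤ.* + 1
    eq = trans (solve 2 (λ a b → (a :* con (+ 1) :+ b :* con (+ 1)) :* con (+ 1) := (a :+ b) :* con (+ 1)) refl (+ m) (+ n))
               (cong (ℤ._* + 1) (ℤP.pos-+ m n))

  ⟦*⟧ : ∀ m n → ⟦ m ℕ.* n ⟧ ≡ ⟦ m ⟧ * ⟦ n ⟧
  ⟦*⟧ m n = sym (trans (fromℚᵘ-homo-* (U.mkℚᵘ (+ m) 0) (U.mkℚᵘ (+ n) 0))
    (fromℚᵘ-cong {U.mkℚᵘ (+ m) 0 U.* U.mkℚᵘ (+ n) 0} {U.mkℚᵘ (+ (m ℕ.* n)) 0}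
      (U.*≡* (cong (ℤ._* + 1) (sym (ℤP.pos-* m n))))))

  1/m*m≡1 : ∀ m .{{_ : ℕ.NonZero m}} → (+ 1 ℚ./ m) * ⟦ m ⟧ ≡ 1ℚ
  1/m*m≡1 (suc k) = trans (fromℚᵘ-homo-* (U.mkℚᵘ (+ 1) k) (U.mkℚᵘ (+ suc k) 0))
    (fromℚᵘ-cong {U.mkℚᵘ (+ 1) k U.* U.mkℚᵘ (+ suc k) 0} {U.mkℚᵘ (+ 1) 0} (U.*≡* eq))
    where
    eq : (+ 1 ℤ.* + suc k) ℤ.* + 1 ≡ + 1 ℤ.* + (suc k ℕ.* 1)
    eq = trans (ℤP.*-identityʳ _) (cong (λ z → + 1 ℤ.* + z) (sym (ℕP.*-identityʳ (suc k))))
      where import Data.Nat.Properties as ℕP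

  ⟦suc⟧≢0 : ∀ m → ⟦ suc m ⟧ ≢ 0ℚ
  ⟦suc⟧≢0 m p = 1≢0 (begin
    1ℚ                        ≡⟨ sym (1/m*m≡1 (suc m)) ⟩
    u * ⟦ suc m ⟧             ≡⟨ cong (u *_) p ⟩
    u * 0ℚ                    ≡⟨ *-zeroʳ u ⟩
    0ℚ                        ∎)
    where
    open ≡-Reasoning
    u = + 1 ℚ./ suc m

  *-cancelˡ-≢0 : ∀ {c y z} → c ≢ 0ℚ → c * y ≡ c * z → y ≡ z
  *-cancelˡ-≢0 {c} {y} {z} c≢0 p = begin
    y            ≡⟨ sym (*-identityˡ y) ⟩
    1ℚ * y       ≡⟨ cong (_* y) (sym (*-inverseˡ c)) ⟩
    (u * c) * y  ≡⟨ *-assoc u c y ⟩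
    u * (c * y)  ≡⟨ cong (u *_) p ⟩
    u * (c * z)  ≡⟨ sym (*-assoc u c z) ⟩
    (u * c) * z  ≡⟨ cong (_* z) (*-inverseˡ c) ⟩
    1ℚ * z       ≡⟨ *-identityˡ z ⟩
    z            ∎
    where
    open ≡-Reasoning
    instance
      c-nonZero : ℚ.NonZero c
      c-nonZero = ℚ.≢-nonZero c≢0
    u = ℚ.1/ c

  inverse-unique : ∀ {x y z} → y * x ≡ 1ℚ → z * x ≡ 1ℚ → y ≡ z
  inverse-unique {x} {y} {z} p q = begin
    y             ≡⟨ sym (*-identityʳ y) ⟩
    y * 1ℚ        ≡⟨ cong (y *_) (sym q) ⟩
    y * (z * x)   ≡⟨ solve 3 (λ x y z → y :* (z :* x) := (y :* x) :* z) refl x y z ⟩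
    (y * x) * z   ≡⟨ cong (_* z) p ⟩
    1ℚ * z        ≡⟨ *-identityˡ z ⟩
    z             ∎
    where
    open ≡-Reasoning
    open ℚ-Solver using (solve; _:*_; _:=_)

  1/fact : ℕ → ℚ
  1/fact n = (+ 1 ℚ./ (n !)) {{n !≢0}}

  -- (n+1) · 1/(n+1)! = 1/n!, since both sides are inverse to n!.
  1/fact-step : ∀ n → ⟦ suc n ⟧ * 1/fact (suc n) ≡ 1/fact n
  1/fact-step n = inverse-unique {x = ⟦ n ! ⟧} (begin
    ⟦ suc n ⟧ * 1/fact (suc n) * ⟦ n ! ⟧    ≡⟨ solve 3 (λ a b c → a :* b :* c := b :* (a :* c)) refl ⟦ suc n ⟧ (1/fact (suc n)) ⟦ n ! ⟧ ⟩
    1/fact (suc n) * (⟦ suc n ⟧ * ⟦ n ! ⟧)  ≡⟨ cong (1/fact (suc n) *_) (sym (⟦*⟧ (suc n) (n !))) ⟩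
    1/fact (suc n) * ⟦ suc n ! ⟧            ≡⟨ 1/m*m≡1 (suc n !) {{suc n !≢0}} ⟩
    1ℚ                                      ∎)
    (1/m*m≡1 (n !) {{n !≢0}})
    where
    open ≡-Reasoning
    open ℚ-Solver using (solve; _:*_; _:=_)

module PowerSeries where
  open import Data.Nat as ℕ using (ℕ; zero; suc)
  open import Data.Rational using (ℚ; 0ℚ; _+_; _*_; -_)
  open import Data.Rational.Properties
  open import Data.Rational.Solver
  open +-*-Solver using (solve; _:+_; _:*_; :-_; _:=_)
  open import Relation.Binary.PropositionalEquality

  infix 4 _≐_
  _≐_ : PS → PS → Set
  f ≐ g = ∀ n → f n ≡ g n

  ≐-refl : ∀ {f} → f ≐ f
  ≐-refl n = refl

  ≐-sym : ∀ {f g} → f ≐ g → g ≐ f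
  ≐-sym p n = sym (p n)

  infixl 6 _⊕_
  infixl 7 _⊙_
  _⊕_ : PS → PS → PS
  (f ⊕ g) n = f n + g n

  _⊙_ : ℚ → PS → PS
  (c ⊙ f) n = c * f n

  ⊖_ : PS → PS
  (⊖ f) n = - f n

  zeroPS : PS
  zeroPS n = 0ℚ

  tail : PS → PS
  tail f i = f (suc i)

  shift : PS → PS
  shift f zero    = 0ℚ
  shift f (suc n) = f n

  -- This is the form used in all
  -- inductive proofs below; it agrees with the Cauchy product _*PS_.
  conv : PS → PS → PS
  conv f g zero    = f 0 * g 0
  conv f g (suc n) = f 0 * g (suc n) + conv (tail f) g n

  -- Splitting off the first summand turns the sum defining _*PS_ into conv.
  sumTo-first : ∀ h n → sumTo h (suc n) ≡ h 0 + sumTo (λ i → h (suc i)) n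
  sumTo-first h zero    = refl
  sumTo-first h (suc n) = trans (cong (_+ h (suc (suc n))) (sumTo-first h n)) (+-assoc (h 0) _ _)

  *PS≐conv : ∀ f g → f *PS g ≐ conv f g
  *PS≐conv f g zero    = refl
  *PS≐conv f g (suc n) = trans (sumTo-first _ n) (cong (f 0 * g (suc n) +_) (*PS≐conv (tail f) g n))

  conv-cong : ∀ {f f' g g'} → f ≐ f' → g ≐ g' → conv f g ≐ conv f' g'
  conv-cong p q zero    = cong₂ _*_ (p 0) (q 0)
  conv-cong p q (suc n) = cong₂ _+_ (cong₂ _*_ (p 0) (q (suc n))) (conv-cong (λ i → p (suc i)) q n)

  conv-zeroˡ : ∀ g → conv zeroPS g ≐ zeroPS
  conv-zeroˡ g zero    = *-zeroˡ (g 0)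
  conv-zeroˡ g (suc n) = trans (cong₂ _+_ (*-zeroˡ (g (suc n))) (conv-zeroˡ g n)) (+-identityˡ 0ℚ)

  conv-oneˡ : ∀ g → conv onePS g ≐ g
  conv-oneˡ g zero    = *-identityˡ (g 0)
  conv-oneˡ g (suc n) = trans (cong₂ _+_ (*-identityˡ (g (suc n))) (conv-zeroˡ g n)) (+-identityʳ (g (suc n)))

  conv-distˡ : ∀ f h g → conv (f ⊕ h) g ≐ conv f g ⊕ conv h g
  conv-distˡ f h g zero    = *-distribʳ-+ (g 0) (f 0) (h 0)
  conv-distˡ f h g (suc n) = trans (cong ((f 0 + h 0) * g (suc n) +_) (conv-distˡ (tail f) (tail h) g n))
    (solve 5 (λ a b c x y → (a :+ b) :* c :+ (x :+ y) := (a :* c :+ x) :+ (b :* c :+ y)) refl (f 0) (h 0) (g (suc n)) _ _)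

  conv-scaleˡ : ∀ c f g → conv (c ⊙ f) g ≐ c ⊙ conv f g
  conv-scaleˡ c f g zero    = *-assoc c (f 0) (g 0)
  conv-scaleˡ c f g (suc n) = trans (cong (c * f 0 * g (suc n) +_) (conv-scaleˡ c (tail f) g n))
    (solve 4 (λ c a b x → c :* a :* b :+ c :* x := c :* (a :* b :+ x)) refl c (f 0) (g (suc n)) _)

  conv-negˡ : ∀ f g → conv (⊖ f) g ≐ ⊖ conv f g
  conv-negˡ f g zero    = sym (neg-distribˡ-* (f 0) (g 0))
  conv-negˡ f g (suc n) = trans (cong (- f 0 * g (suc n) +_) (conv-negˡ (tail f) g n))
    (solve 3 (λ a b x → :- a :* b :+ :- x := :- (a :* b :+ x)) refl (f 0) (g (suc n)) (conv (tail f) g n))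

  conv-shiftˡ : ∀ f g → conv (shift f) g ≐ shift (conv f g)
  conv-shiftˡ f g zero    = *-zeroˡ (g 0)
  conv-shiftˡ f g (suc n) = trans (cong (_+ conv f g n) (*-zeroˡ (g (suc n)))) (+-identityˡ _)

  -- Commutativity: peel off the constant terms of both factors.
  conv-comm : ∀ f g → conv f g ≐ conv g f
  conv-comm f g zero          = *-comm (f 0) (g 0)
  conv-comm f g (suc zero)    = solve 4 (λ a b c d → a :* b :+ c :* d := d :* c :+ b :* a) refl (f 0) (g 1) (f 1) (g 0)
  conv-comm f g (suc (suc n)) = begin
      f 0 * g (suc (suc n)) + conv (tail f) g (suc n)
    ≡⟨ cong (f 0 * g (suc (suc n)) +_) (conv-comm (tail f) g (suc n)) ⟩
      f 0 * g (suc (suc n)) + (g 0 * f (suc (suc n)) + conv (tail g) (tail f) n)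
    ≡⟨ cong (λ z → f 0 * g (suc (suc n)) + (g 0 * f (suc (suc n)) + z)) (conv-comm (tail g) (tail f) n) ⟩
      f 0 * g (suc (suc n)) + (g 0 * f (suc (suc n)) + conv (tail f) (tail g) n)
    ≡⟨ solve 5 (λ a b c d x → a :* b :+ (c :* d :+ x) := c :* d :+ (a :* b :+ x)) refl (f 0) (g (suc (suc n))) (g 0) (f (suc (suc n))) _ ⟩
      g 0 * f (suc (suc n)) + (f 0 * g (suc (suc n)) + conv (tail f) (tail g) n)
    ≡⟨ cong (g 0 * f (suc (suc n)) +_) (sym (conv-comm (tail g) f (suc n))) ⟩
      g 0 * f (suc (suc n)) + conv (tail g) f (suc n)
    ∎
    where open ≡-Reasoning

  -- Associativity: expand the constant term of conv f g and distribute.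
  conv-assoc : ∀ f g h → conv (conv f g) h ≐ conv f (conv g h)
  conv-assoc f g h zero    = *-assoc (f 0) (g 0) (h 0)
  conv-assoc f g h (suc n) = begin
      f 0 * g 0 * h (suc n) + conv (f 0 ⊙ tail g ⊕ conv (tail f) g) h n
    ≡⟨ cong (f 0 * g 0 * h (suc n) +_) (conv-distˡ (f 0 ⊙ tail g) (conv (tail f) g) h n) ⟩
      f 0 * g 0 * h (suc n) + (conv (f 0 ⊙ tail g) h n + conv (conv (tail f) g) h n)
    ≡⟨ cong₂ (λ u v → f 0 * g 0 * h (suc n) + (u + v)) (conv-scaleˡ (f 0) (tail g) h n) (conv-assoc (tail f) g h n) ⟩
      f 0 * g 0 * h (suc n) + (f 0 * conv (tail g) h n + conv (tail f) (conv g h) n)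
    ≡⟨ solve 5 (λ a b c x y → a :* b :* c :+ (a :* x :+ y) := a :* (b :* c :+ x) :+ y) refl (f 0) (g 0) (h (suc n)) _ _ ⟩
      f 0 * (g 0 * h (suc n) + conv (tail g) h n) + conv (tail f) (conv g h) n
    ∎
    where open ≡-Reasoning

  conv-zeroʳ : ∀ f → conv f zeroPS ≐ zeroPS
  conv-zeroʳ f n = trans (conv-comm f zeroPS n) (conv-zeroˡ f n)

  conv-oneʳ : ∀ f → conv f onePS ≐ f
  conv-oneʳ f n = trans (conv-comm f onePS n) (conv-oneˡ f n)

  conv-distʳ : ∀ f g h → conv f (g ⊕ h) ≐ conv f g ⊕ conv f h
  conv-distʳ f g h n = trans (conv-comm f (g ⊕ h) n)
    (trans (conv-distˡ g h f n) (cong₂ _+_ (conv-comm g f n) (conv-comm h f n)))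

  conv-scaleʳ : ∀ c f g → conv f (c ⊙ g) ≐ c ⊙ conv f g
  conv-scaleʳ c f g n = trans (conv-comm f (c ⊙ g) n) (trans (conv-scaleˡ c g f n) (cong (c *_) (conv-comm g f n)))

  conv-negʳ : ∀ f g → conv f (⊖ g) ≐ ⊖ conv f g
  conv-negʳ f g n = trans (conv-comm f (⊖ g) n) (trans (conv-negˡ g f n) (cong -_ (conv-comm g f n)))

  conv-interchange : ∀ A B C D → conv (conv A B) (conv C D) ≐ conv (conv A C) (conv B D)
  conv-interchange A B C D n = begin
    conv (conv A B) (conv C D) n  ≡⟨ conv-assoc A B (conv C D) n ⟩
    conv A (conv B (conv C D)) n  ≡⟨ conv-cong ≐-refl middle n ⟩
    conv A (conv C (conv B D)) n  ≡⟨ sym (conv-assoc A C (conv B D) n) ⟩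
    conv (conv A C) (conv B D) n  ∎
    where
    open ≡-Reasoning
    middle : conv B (conv C D) ≐ conv C (conv B D)
    middle i = trans (sym (conv-assoc B C D i)) (trans (conv-cong (conv-comm B C) ≐-refl i) (conv-assoc C B D i))

  conv-inverse-unique : ∀ {e f g} → conv e f ≐ onePS → conv e g ≐ onePS → f ≐ g
  conv-inverse-unique {e} {f} {g} p q n = begin
    f n                   ≡⟨ sym (conv-oneˡ f n) ⟩
    conv onePS f n        ≡⟨ sym (conv-cong (λ i → trans (conv-comm g e i) (q i)) ≐-refl n) ⟩
    conv (conv g e) f n   ≡⟨ conv-assoc g e f n ⟩
    conv g (conv e f) n   ≡⟨ conv-cong ≐-refl p n ⟩
    conv g onePS n        ≡⟨ conv-oneʳ g n ⟩
    g n                   ∎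
    where open ≡-Reasoning

  powPS-+ : ∀ f n m → powPS f (n ℕ.+ m) ≐ conv (powPS f n) (powPS f m)
  powPS-+ f zero    m i = sym (conv-oneˡ (powPS f m) i)
  powPS-+ f (suc n) m i = begin
    (f *PS powPS f (n ℕ.+ m)) i                  ≡⟨ *PS≐conv f _ i ⟩
    conv f (powPS f (n ℕ.+ m)) i                 ≡⟨ conv-cong ≐-refl (powPS-+ f n m) i ⟩
    conv f (conv (powPS f n) (powPS f m)) i      ≡⟨ sym (conv-assoc f _ _ i) ⟩
    conv (conv f (powPS f n)) (powPS f m) i      ≡⟨ conv-cong (≐-sym (*PS≐conv f (powPS f n))) ≐-refl i ⟩
    conv (f *PS powPS f n) (powPS f m) i         ∎
    where open ≡-Reasoning

  shift-cong : ∀ {f g} → f ≐ g → shift f ≐ shift g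
  shift-cong p zero    = refl
  shift-cong p (suc n) = p n

  shift-scale : ∀ a f → shift (a ⊙ f) ≐ a ⊙ shift f
  shift-scale a f zero    = sym (*-zeroʳ a)
  shift-scale a f (suc n) = refl

  conv-scale-shiftˡ : ∀ c f g → c ⊙ shift (conv f g) ≐ conv (c ⊙ shift f) g
  conv-scale-shiftˡ c f g n = sym (trans (conv-scaleˡ c (shift f) g n) (cong (c *_) (conv-shiftˡ f g n)))

  shiftBy : ℕ → PS → PS
  shiftBy zero    f = f
  shiftBy (suc j) f = shift (shiftBy j f)

  shiftBy-cong : ∀ j {f g} → f ≐ g → shiftBy j f ≐ shiftBy j g
  shiftBy-cong zero    p = p
  shiftBy-cong (suc j) p = shift-cong (shiftBy-cong j p)

  shiftBy-⊕ : ∀ j f g → shiftBy j (f ⊕ g) ≐ shiftBy j f ⊕ shiftBy j g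
  shiftBy-⊕ zero    f g n       = refl
  shiftBy-⊕ (suc j) f g zero    = sym (+-identityʳ 0ℚ)
  shiftBy-⊕ (suc j) f g (suc n) = shiftBy-⊕ j f g n

  shiftBy-zero : ∀ j → shiftBy j zeroPS ≐ zeroPS
  shiftBy-zero zero    n       = refl
  shiftBy-zero (suc j) zero    = refl
  shiftBy-zero (suc j) (suc n) = shiftBy-zero j n

  shiftBy-scale : ∀ j c f → shiftBy j (c ⊙ f) ≐ c ⊙ shiftBy j f
  shiftBy-scale zero    c f n = refl
  shiftBy-scale (suc j) c f n = trans (shift-cong (shiftBy-scale j c f) n) (shift-scale c (shiftBy j f) n)

  shiftBy-+ : ∀ i j f → shiftBy i (shiftBy j f) ≐ shiftBy (i ℕ.+ j) f
  shiftBy-+ zero    j f n = refl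
  shiftBy-+ (suc i) j f   = shift-cong (shiftBy-+ i j f)

  shiftBy-at : ∀ j f t → shiftBy j f (j ℕ.+ t) ≡ f t
  shiftBy-at zero    f t = refl
  shiftBy-at (suc j) f t = shiftBy-at j f t

  shiftBy-below : ∀ j f i → i ℕ.< j → shiftBy j f i ≡ 0ℚ
  shiftBy-below (suc j) f zero    _            = refl
  shiftBy-below (suc j) f (suc i) (ℕ.s≤s i<j) = shiftBy-below j f i i<j

  conv-shiftByˡ : ∀ j f g → conv (shiftBy j f) g ≐ shiftBy j (conv f g)
  conv-shiftByˡ zero    f g n = refl
  conv-shiftByˡ (suc j) f g n = trans (conv-shiftˡ (shiftBy j f) g n) (shift-cong (conv-shiftByˡ j f g) n)

  conv-shiftByʳ : ∀ j f g → conv f (shiftBy j g) ≐ shiftBy j (conv f g)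
  conv-shiftByʳ j f g n = trans (conv-comm f (shiftBy j g) n)
    (trans (conv-shiftByˡ j g f n) (shiftBy-cong j (conv-comm g f) n))

module Exponential where
  open import Data.Nat using (zero; suc)
  open import Data.Rational using (0ℚ; 1ℚ; _+_; _*_)
  open import Data.Rational.Properties
  open import Data.Rational.Solver
  open +-*-Solver using (solve; _:+_; _:*_; _:=_; con)
  open import Relation.Binary.PropositionalEquality
  open Numerals
  open PowerSeries

  pow-* : ∀ c a n → pow (c * a) n ≡ pow c n * pow a n
  pow-* c a zero    = refl
  pow-* c a (suc n) = trans (cong (c * a *_) (pow-* c a n))
    (solve 4 (λ c a x y → c :* a :* (x :* y) := c :* x :* (a :* y)) refl c a (pow c n) (pow a n))

  pow-1 : ∀ n → pow 1ℚ n ≡ 1ℚ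
  pow-1 zero    = refl
  pow-1 (suc n) = cong (1ℚ *_) (pow-1 n)

  substPS-cong : ∀ c {f g} → f ≐ g → substPS c f ≐ substPS c g
  substPS-cong c p n = cong (pow c n *_) (p n)

  substPS-one : ∀ c → substPS c onePS ≐ onePS
  substPS-one c zero    = refl
  substPS-one c (suc n) = *-zeroʳ (c * pow c n)

  substPS-conv : ∀ c f g → substPS c (conv f g) ≐ conv (substPS c f) (substPS c g)
  substPS-conv c f g zero    = solve 2 (λ a b → con 1ℚ :* (a :* b) := (con 1ℚ :* a) :* (con 1ℚ :* b)) refl (f 0) (g 0)
  substPS-conv c f g (suc n) = begin
      c * pow c n * (f 0 * g (suc n) + conv (tail f) g n)
    ≡⟨ solve 5 (λ c p a b x → c :* p :* (a :* b :+ x) := con 1ℚ :* a :* (c :* p :* b) :+ c :* (p :* x)) refl c (pow c n) (f 0) (g (suc n)) (conv (tail f) g n) ⟩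
      1ℚ * f 0 * (c * pow c n * g (suc n)) + c * (pow c n * conv (tail f) g n)
    ≡⟨ cong (1ℚ * f 0 * (c * pow c n * g (suc n)) +_) tail-part ⟩
      1ℚ * f 0 * (c * pow c n * g (suc n)) + conv (tail (substPS c f)) (substPS c g) n
    ∎
    where
    open ≡-Reasoning
    tail-part : c * (pow c n * conv (tail f) g n) ≡ conv (tail (substPS c f)) (substPS c g) n
    tail-part = begin
      c * (pow c n * conv (tail f) g n)                     ≡⟨ cong (c *_) (substPS-conv c (tail f) g n) ⟩
      c * conv (substPS c (tail f)) (substPS c g) n         ≡⟨ sym (conv-scaleˡ c (substPS c (tail f)) (substPS c g) n) ⟩
      conv (c ⊙ substPS c (tail f)) (substPS c g) n         ≡⟨ conv-cong (λ i → sym (*-assoc c (pow c i) (f (suc i)))) ≐-refl n ⟩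
      conv (tail (substPS c f)) (substPS c g) n             ∎

  substPS-shift : ∀ c f → substPS c (shift f) ≐ c ⊙ shift (substPS c f)
  substPS-shift c f zero    = trans (*-zeroʳ 1ℚ) (sym (*-zeroʳ c))
  substPS-shift c f (suc n) = *-assoc c (pow c n) (f n)

  substPS-exp : ∀ c a → substPS c (expPS a) ≐ expPS (c * a)
  substPS-exp c a n = trans (sym (*-assoc (pow c n) (pow a n) (1/fact n))) (cong (_* 1/fact n) (sym (pow-* c a n)))

  expPS-at-0 : ∀ a → expPS a 0 ≡ 1ℚ
  expPS-at-0 a = *-identityˡ 1ℚ

  expPS-zero : expPS 0ℚ ≐ onePS
  expPS-zero zero    = expPS-at-0 0ℚ
  expPS-zero (suc n) = trans (cong (_* 1/fact (suc n)) (*-zeroˡ (pow 0ℚ n))) (*-zeroˡ (1/fact (suc n)))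

  D : PS → PS
  D f n = ⟦ suc n ⟧ * f (suc n)

  D-conv : ∀ f g → D (conv f g) ≐ conv (D f) g ⊕ conv f (D g)
  D-conv f g zero    = solve 4 (λ a b c d → con 1ℚ :* (a :* b :+ c :* d) := (con 1ℚ :* c) :* d :+ a :* (con 1ℚ :* b)) refl (f 0) (g 1) (f 1) (g 0)
  D-conv f g (suc m) = sym (begin
      (1ℚ * f 1 * g (suc m) + conv (tail (D f)) g m) + (f 0 * (⟦ suc (suc m) ⟧ * G) + Q)
    ≡⟨ cong (λ z → (1ℚ * f 1 * g (suc m) + z) + (f 0 * (⟦ suc (suc m) ⟧ * G) + Q))
         (trans (conv-cong tail-D ≐-refl m) (conv-distˡ (tail (tail f)) (D (tail f)) g m)) ⟩
      (1ℚ * f 1 * g (suc m) + (Y + P)) + (f 0 * (⟦ suc (suc m) ⟧ * G) + Q)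
    ≡⟨ solve 8 (λ a b y p f0 k g q → (con 1ℚ :* a :* b :+ (y :+ p)) :+ (f0 :* (k :* g) :+ q) := (a :* b :+ y) :+ (p :+ q) :+ f0 :* (k :* g)) refl (f 1) (g (suc m)) Y P (f 0) ⟦ suc (suc m) ⟧ G Q ⟩
      (A + Y) + (P + Q) + f 0 * (⟦ suc (suc m) ⟧ * G)
    ≡⟨ cong₂ (λ u v → (A + Y) + u + f 0 * (v * G)) (sym (D-conv (tail f) g m)) (⟦+⟧ 1 (suc m)) ⟩
      (A + Y) + ⟦ suc m ⟧ * (A + Y) + f 0 * ((1ℚ + ⟦ suc m ⟧) * G)
    ≡⟨ solve 4 (λ x k f0 g → x :+ k :* x :+ f0 :* ((con 1ℚ :+ k) :* g) := (con 1ℚ :+ k) :* (f0 :* g :+ x)) refl (A + Y) ⟦ suc m ⟧ (f 0) G ⟩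
      (1ℚ + ⟦ suc m ⟧) * (f 0 * G + (A + Y))
    ≡⟨ cong (_* (f 0 * G + (A + Y))) (sym (⟦+⟧ 1 (suc m))) ⟩
      ⟦ suc (suc m) ⟧ * (f 0 * G + (A + Y))
    ∎)
    where
    open ≡-Reasoning
    A = f 1 * g (suc m)
    Y = conv (tail (tail f)) g m
    P = conv (D (tail f)) g m
    Q = conv (tail f) (D g) m
    G = g (suc (suc m))
    tail-D : tail (D f) ≐ tail (tail f) ⊕ D (tail f)
    tail-D i = trans (cong (_* f (suc (suc i))) (⟦+⟧ 1 (suc i)))
      (trans (*-distribʳ-+ (f (suc (suc i))) 1ℚ ⟦ suc i ⟧) (cong (_+ ⟦ suc i ⟧ * f (suc (suc i))) (*-identityˡ (f (suc (suc i))))))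

  -- d/dT e^{aT} = a e^{aT}, from (n+1) · 1/(n+1)! = 1/n!.
  D-exp : ∀ a → D (expPS a) ≐ a ⊙ expPS a
  D-exp a n = begin
    ⟦ suc n ⟧ * (a * pow a n * 1/fact (suc n))    ≡⟨ solve 4 (λ k a p x → k :* (a :* p :* x) := a :* (p :* (k :* x))) refl ⟦ suc n ⟧ a (pow a n) (1/fact (suc n)) ⟩
    a * (pow a n * (⟦ suc n ⟧ * 1/fact (suc n)))  ≡⟨ cong (λ z → a * (pow a n * z)) (1/fact-step n) ⟩
    a * (pow a n * 1/fact n)                      ∎
    where open ≡-Reasoning

  D-eigen-unique : ∀ h c → D h ≐ c ⊙ h → h ≐ h 0 ⊙ expPS c
  D-eigen-unique h c p zero    = sym (trans (cong (h 0 *_) (expPS-at-0 c)) (*-identityʳ (h 0)))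
  D-eigen-unique h c p (suc n) = *-cancelˡ-≢0 (⟦suc⟧≢0 n) (begin
    ⟦ suc n ⟧ * h (suc n)                ≡⟨ p n ⟩
    c * h n                              ≡⟨ cong (c *_) (D-eigen-unique h c p n) ⟩
    c * (h 0 * expPS c n)                ≡⟨ solve 3 (λ c h e → c :* (h :* e) := h :* (c :* e)) refl c (h 0) (expPS c n) ⟩
    h 0 * (c * expPS c n)                ≡⟨ cong (h 0 *_) (sym (D-exp c n)) ⟩
    h 0 * (⟦ suc n ⟧ * expPS c (suc n))  ≡⟨ solve 3 (λ h k e → h :* (k :* e) := k :* (h :* e)) refl (h 0) ⟦ suc n ⟧ (expPS c (suc n)) ⟩
    ⟦ suc n ⟧ * (h 0 * expPS c (suc n))  ∎)
    where open ≡-Reasoning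

  -- e^{aT} e^{bT} = e^{(a+b)T}: both sides solve h' = (a+b) h, h(0) = 1.
  expPS-+ : ∀ a b → conv (expPS a) (expPS b) ≐ expPS (a + b)
  expPS-+ a b n = trans (D-eigen-unique h (a + b) Dh n) (trans (cong (_* expPS (a + b) n) h0) (*-identityˡ _))
    where
    h = conv (expPS a) (expPS b)
    h0 : h 0 ≡ 1ℚ
    h0 = cong₂ _*_ (expPS-at-0 a) (expPS-at-0 b)
    Dh : D h ≐ (a + b) ⊙ h
    Dh n = begin
      D h n                                                              ≡⟨ D-conv (expPS a) (expPS b) n ⟩
      conv (D (expPS a)) (expPS b) n + conv (expPS a) (D (expPS b)) n    ≡⟨ cong₂ _+_
        (trans (conv-cong (D-exp a) ≐-refl n) (conv-scaleˡ a (expPS a) (expPS b) n))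
        (trans (conv-cong ≐-refl (D-exp b) n) (conv-scaleʳ b (expPS a) (expPS b) n)) ⟩
      a * h n + b * h n                                                  ≡⟨ sym (*-distribʳ-+ (h n) a b) ⟩
      (a + b) * h n                                                      ∎
      where open ≡-Reasoning

module Bernoulli where
  open import Data.Nat using (ℕ; zero; suc; _∸_)
  import Data.Integer as ℤ
  open import Data.Rational as ℚ using (ℚ; 0ℚ; 1ℚ; _+_; _*_; -_)
  open import Data.Rational.Properties
  open import Data.Rational.Solver
  open +-*-Solver using (solve; _:+_; _:*_; :-_; _:=_; con)
  open import Data.List using (_∷_; foldr; map; zipWith; applyUpTo)
  open import Data.List.Properties using (map-applyUpTo)
  open import Relation.Binary.PropositionalEquality
  open Numerals
  open PowerSeries
  open Exponential

  zipWith-applyUpTo : ∀ (u v : ℕ → ℚ) m →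
    zipWith _*_ (applyUpTo u m) (applyUpTo v m) ≡ applyUpTo (λ i → u i * v i) m
  zipWith-applyUpTo u v zero    = refl
  zipWith-applyUpTo u v (suc m) = cong (u 0 * v 0 ∷_) (zipWith-applyUpTo (λ i → u (suc i)) (λ i → v (suc i)) m)

  foldr-applyUpTo : ∀ w n → foldr _+_ 0ℚ (applyUpTo w (suc n)) ≡ sumTo w n
  foldr-applyUpTo w zero    = +-identityʳ (w 0)
  foldr-applyUpTo w (suc n) = trans (cong (w 0 +_) (foldr-applyUpTo (λ i → w (suc i)) n)) (sym (sumTo-first w n))

  invList-eq : ∀ f n → invList f n ≡ applyUpTo (λ j → inv1PS f (n ∸ j)) (suc n)
  invList-eq f zero    = refl
  invList-eq f (suc n) = cong (inv1PS f (suc n) ∷_) (invList-eq f n)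

  inv1PS-step : ∀ f n → inv1PS f (suc n) ≡ - conv (tail f) (inv1PS f) n
  inv1PS-step f n = cong -_ (begin
      foldr _+_ 0ℚ (zipWith _*_ (map (λ i → f (suc i)) (applyUpTo (λ i → i) (suc n))) (invList f n))
    ≡⟨ cong₂ (λ a b → foldr _+_ 0ℚ (zipWith _*_ a b)) (map-applyUpTo (λ i → i) (λ i → f (suc i)) (suc n)) (invList-eq f n) ⟩
      foldr _+_ 0ℚ (zipWith _*_ (applyUpTo (λ i → f (suc i)) (suc n)) (applyUpTo (λ j → inv1PS f (n ∸ j)) (suc n)))
    ≡⟨ cong (foldr _+_ 0ℚ) (zipWith-applyUpTo (λ i → f (suc i)) (λ j → inv1PS f (n ∸ j)) (suc n)) ⟩
      foldr _+_ 0ℚ (applyUpTo (λ i → f (suc i) * inv1PS f (n ∸ i)) (suc n))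
    ≡⟨ foldr-applyUpTo _ n ⟩
      (tail f *PS inv1PS f) n
    ≡⟨ *PS≐conv (tail f) (inv1PS f) n ⟩
      conv (tail f) (inv1PS f) n ∎)
    where open ≡-Reasoning

  inv1PS-inverse : ∀ f → f 0 ≡ 1ℚ → conv f (inv1PS f) ≐ onePS
  inv1PS-inverse f p zero    = trans (*-identityʳ (f 0)) p
  inv1PS-inverse f p (suc n) = trans (cong₂ (λ a b → a * b + conv (tail f) (inv1PS f) n) p (inv1PS-step f n))
    (solve 1 (λ x → con 1ℚ :* (:- x) :+ x := con 0ℚ) refl (conv (tail f) (inv1PS f) n))

  𝐄 : ℚ → PS
  𝐄 c = substPS c expm1divT

  𝐁 : ℚ → PS
  𝐁 c = substPS c Bser

  𝐄-𝐁-inverse : ∀ c → conv (𝐄 c) (𝐁 c) ≐ onePS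
  𝐄-𝐁-inverse c n = trans (sym (substPS-conv c expm1divT Bser n))
    (trans (substPS-cong c (inv1PS-inverse expm1divT refl) n) (substPS-one c n))

  T·expm1divT : shift expm1divT ≐ expPS 1ℚ ⊕ ⊖ onePS
  T·expm1divT zero    = sym (trans (cong (_+ - 1ℚ) (expPS-at-0 1ℚ)) (+-inverseʳ 1ℚ))
  T·expm1divT (suc n) = sym (trans (+-identityʳ _) (trans (cong (_* 1/fact (suc n)) (pow-1 (suc n))) (*-identityˡ _)))

  cT·𝐄 : ∀ c → c ⊙ shift (𝐄 c) ≐ expPS c ⊕ ⊖ onePS
  cT·𝐄 c n = begin
    c * shift (𝐄 c) n                        ≡⟨ sym (substPS-shift c expm1divT n) ⟩
    pow c n * shift expm1divT n              ≡⟨ cong (pow c n *_) (T·expm1divT n) ⟩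
    pow c n * (expPS 1ℚ n + - onePS n)       ≡⟨ solve 3 (λ p e o → p :* (e :+ :- o) := p :* e :+ :- (p :* o)) refl (pow c n) (expPS 1ℚ n) (onePS n) ⟩
    substPS c (expPS 1ℚ) n + - substPS c onePS n
      ≡⟨ cong₂ (λ a b → a + - b) (trans (substPS-exp c 1ℚ n) (cong (λ z → expPS z n) (*-identityʳ c))) (substPS-one c n) ⟩
    expPS c n + - onePS n                    ∎
    where open ≡-Reasoning

  cT·-injective : ∀ {c f g} → c ≢ 0ℚ → c ⊙ shift f ≐ c ⊙ shift g → f ≐ g
  cT·-injective c≢0 p n = *-cancelˡ-≢0 c≢0 (p (suc n))

  -- 𝐄(-c) e^{cT} = 𝐄(c), as cT times both sides is e^{cT} - 1.
  𝐄-reflection : ∀ c → c ≢ 0ℚ → conv (𝐄 (- c)) (expPS c) ≐ 𝐄 c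
  𝐄-reflection c c≢0 = cT·-injective c≢0 λ n → begin
    c * shift (conv (𝐄 (- c)) (expPS c)) n         ≡⟨ conv-scale-shiftˡ c (𝐄 (- c)) (expPS c) n ⟩
    conv (c ⊙ shift (𝐄 (- c))) (expPS c) n         ≡⟨ conv-cong cT·𝐄[-c] ≐-refl n ⟩
    conv (onePS ⊕ ⊖ expPS (- c)) (expPS c) n       ≡⟨ conv-distˡ onePS (⊖ expPS (- c)) (expPS c) n ⟩
    conv onePS (expPS c) n + conv (⊖ expPS (- c)) (expPS c) n
      ≡⟨ cong₂ _+_ (conv-oneˡ (expPS c) n) (conv-negˡ (expPS (- c)) (expPS c) n) ⟩
    expPS c n + - conv (expPS (- c)) (expPS c) n   ≡⟨ cong (λ z → expPS c n + - z) (e⁻ᶜeᶜ≡1 n) ⟩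
    expPS c n + - onePS n                          ≡⟨ sym (cT·𝐄 c n) ⟩
    c * shift (𝐄 c) n                              ∎
    where
    open ≡-Reasoning
    e⁻ᶜeᶜ≡1 : conv (expPS (- c)) (expPS c) ≐ onePS
    e⁻ᶜeᶜ≡1 n = trans (expPS-+ (- c) c n) (trans (cong (λ z → expPS z n) (+-inverseˡ c)) (expPS-zero n))
    cT·𝐄[-c] : c ⊙ shift (𝐄 (- c)) ≐ onePS ⊕ ⊖ expPS (- c)
    cT·𝐄[-c] i = begin
      c * shift (𝐄 (- c)) i               ≡⟨ solve 2 (λ c x → c :* x := :- (:- c :* x)) refl c (shift (𝐄 (- c)) i) ⟩
      - (- c * shift (𝐄 (- c)) i)         ≡⟨ cong -_ (cT·𝐄 (- c) i) ⟩
      - (expPS (- c) i + - onePS i)       ≡⟨ solve 2 (λ e o → :- (e :+ :- o) := o :+ :- e) refl (expPS (- c) i) (onePS i) ⟩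
      onePS i + - expPS (- c) i           ∎

  𝐁-reflection : ∀ c → c ≢ 0ℚ → 𝐁 (- c) ≐ conv (𝐁 c) (expPS c)
  𝐁-reflection c c≢0 = conv-inverse-unique {𝐄 (- c)} (𝐄-𝐁-inverse (- c)) λ n → begin
    conv (𝐄 (- c)) (conv (𝐁 c) (expPS c)) n    ≡⟨ conv-cong ≐-refl (conv-comm (𝐁 c) (expPS c)) n ⟩
    conv (𝐄 (- c)) (conv (expPS c) (𝐁 c)) n    ≡⟨ sym (conv-assoc (𝐄 (- c)) (expPS c) (𝐁 c) n) ⟩
    conv (conv (𝐄 (- c)) (expPS c)) (𝐁 c) n    ≡⟨ conv-cong (𝐄-reflection c c≢0) ≐-refl n ⟩
    conv (𝐄 c) (𝐁 c) n                         ≡⟨ 𝐄-𝐁-inverse c n ⟩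
    onePS n                                    ∎
    where open ≡-Reasoning

  geomExp : ℚ → ℕ → PS
  geomExp c zero    = zeroPS
  geomExp c (suc k) = geomExp c k ⊕ expPS (⟦ k ⟧ * c)

  geomExp-telescope : ∀ c k → conv (geomExp c k) (expPS c ⊕ ⊖ onePS) ≐ expPS (⟦ k ⟧ * c) ⊕ ⊖ onePS
  geomExp-telescope c zero n = trans (conv-zeroˡ (expPS c ⊕ ⊖ onePS) n)
    (sym (trans (cong (λ z → expPS z n + - onePS n) (*-zeroˡ c)) (trans (cong (_+ - onePS n) (expPS-zero n)) (+-inverseʳ (onePS n)))))
  geomExp-telescope c (suc k) n = begin
    conv (geomExp c k ⊕ E) M n                           ≡⟨ conv-distˡ (geomExp c k) E M n ⟩
    conv (geomExp c k) M n + conv E M n                  ≡⟨ cong₂ _+_ (geomExp-telescope c k n) (conv-distʳ E (expPS c) (⊖ onePS) n) ⟩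
    (E n + - onePS n) + (conv E (expPS c) n + conv E (⊖ onePS) n)
      ≡⟨ cong₂ (λ a b → (E n + - onePS n) + (a + b)) (expPS-+ (⟦ k ⟧ * c) c n) (trans (conv-negʳ E onePS n) (cong -_ (conv-oneʳ E n))) ⟩
    (E n + - onePS n) + (expPS (⟦ k ⟧ * c + c) n + - E n)
      ≡⟨ solve 3 (λ e o f → (e :+ :- o) :+ (f :+ :- e) := f :+ :- o) refl (E n) (onePS n) (expPS (⟦ k ⟧ * c + c) n) ⟩
    expPS (⟦ k ⟧ * c + c) n + - onePS n                  ≡⟨ cong (λ z → expPS z n + - onePS n) kc+c≡[1+k]c ⟩
    expPS (⟦ suc k ⟧ * c) n + - onePS n                  ∎
    where
    open ≡-Reasoning
    E = expPS (⟦ k ⟧ * c)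
    M = expPS c ⊕ ⊖ onePS
    kc+c≡[1+k]c : ⟦ k ⟧ * c + c ≡ ⟦ suc k ⟧ * c
    kc+c≡[1+k]c = trans (solve 2 (λ k c → k :* c :+ c := (con 1ℚ :+ k) :* c) refl ⟦ k ⟧ c) (cong (_* c) (sym (⟦+⟧ 1 k)))

  -- Dividing the telescoping identity by cT: (Σ_{i<k} e^{icT}) 𝐄(c) = k 𝐄(kc).
  geomExp-𝐄 : ∀ c k → c ≢ 0ℚ → conv (geomExp c k) (𝐄 c) ≐ ⟦ k ⟧ ⊙ 𝐄 (⟦ k ⟧ * c)
  geomExp-𝐄 c k c≢0 = cT·-injective c≢0 λ n → begin
    c * shift (conv G (𝐄 c)) n          ≡⟨ cong (c *_) (shift-cong (conv-comm G (𝐄 c)) n) ⟩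
    c * shift (conv (𝐄 c) G) n          ≡⟨ conv-scale-shiftˡ c (𝐄 c) G n ⟩
    conv (c ⊙ shift (𝐄 c)) G n          ≡⟨ conv-cong (cT·𝐄 c) ≐-refl n ⟩
    conv (expPS c ⊕ ⊖ onePS) G n        ≡⟨ conv-comm _ G n ⟩
    conv G (expPS c ⊕ ⊖ onePS) n        ≡⟨ geomExp-telescope c k n ⟩
    expPS K n + - onePS n               ≡⟨ sym (cT·𝐄 K n) ⟩
    K * shift (𝐄 K) n                   ≡⟨ solve 3 (λ c k x → k :* c :* x := c :* (k :* x)) refl c ⟦ k ⟧ (shift (𝐄 K) n) ⟩
    c * (⟦ k ⟧ * shift (𝐄 K) n)         ≡⟨ cong (c *_) (sym (shift-scale ⟦ k ⟧ (𝐄 K) n)) ⟩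
    c * shift (⟦ k ⟧ ⊙ 𝐄 K) n           ∎
    where
    open ≡-Reasoning
    G = geomExp c k
    K = ⟦ k ⟧ * c

  𝐁-multiplication : ∀ c k → c ≢ 0ℚ → 𝐁 c ≐ (ℤ.+ 1 ℚ./ suc k) ⊙ conv (𝐁 (⟦ suc k ⟧ * c)) (geomExp c (suc k))
  𝐁-multiplication c k c≢0 = conv-inverse-unique {𝐄 c} (𝐄-𝐁-inverse c) λ n → begin
    conv (𝐄 c) (u ⊙ conv (𝐁 K) G) n     ≡⟨ conv-scaleʳ u (𝐄 c) (conv (𝐁 K) G) n ⟩
    u * conv (𝐄 c) (conv (𝐁 K) G) n     ≡⟨ cong (u *_) (𝐄[c]𝐁[K]G n) ⟩
    u * (⟦ suc k ⟧ * onePS n)           ≡⟨ sym (*-assoc u _ _) ⟩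
    (u * ⟦ suc k ⟧) * onePS n           ≡⟨ cong (_* onePS n) (1/m*m≡1 (suc k)) ⟩
    1ℚ * onePS n                        ≡⟨ *-identityˡ _ ⟩
    onePS n                             ∎
    where
    open ≡-Reasoning
    u = ℤ.+ 1 ℚ./ suc k
    K = ⟦ suc k ⟧ * c
    G = geomExp c (suc k)
    𝐄[c]𝐁[K]G : conv (𝐄 c) (conv (𝐁 K) G) ≐ ⟦ suc k ⟧ ⊙ onePS
    𝐄[c]𝐁[K]G n = begin
      conv (𝐄 c) (conv (𝐁 K) G) n         ≡⟨ conv-comm (𝐄 c) _ n ⟩
      conv (conv (𝐁 K) G) (𝐄 c) n         ≡⟨ conv-assoc (𝐁 K) G (𝐄 c) n ⟩
      conv (𝐁 K) (conv G (𝐄 c)) n         ≡⟨ conv-cong ≐-refl (geomExp-𝐄 c (suc k) c≢0) n ⟩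
      conv (𝐁 K) (⟦ suc k ⟧ ⊙ 𝐄 K) n      ≡⟨ conv-scaleʳ ⟦ suc k ⟧ (𝐁 K) (𝐄 K) n ⟩
      ⟦ suc k ⟧ * conv (𝐁 K) (𝐄 K) n      ≡⟨ cong (⟦ suc k ⟧ *_) (trans (conv-comm (𝐁 K) (𝐄 K) n) (𝐄-𝐁-inverse K n)) ⟩
      ⟦ suc k ⟧ * onePS n                 ∎

module CommonMultiple where
  open import Data.Nat as ℕ using (ℕ; zero; suc)
  import Data.Integer as ℤ
  import Data.Integer.Properties as ℤP
  import Data.Nat.Properties as ℕP
  open import Data.Rational as ℚ using (ℚ; 0ℚ; _*_; -_; mkℚ)
  open import Data.Rational.Properties
  open import Data.Rational.Solver
  open +-*-Solver using (solve; _:*_; :-_; _:=_)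
  import Data.Rational.Unnormalised as U
  open import Data.Product using (Σ; _,_; _×_)
  open import Data.Sum using (_⊎_; inj₁; inj₂)
  open import Data.Empty using (⊥-elim)
  open import Relation.Binary.PropositionalEquality
  open Numerals

  -- Clearing the denominator of b ≠ 0 gives ± a positive integer.
  IntegralMultiple : ℚ → Set
  IntegralMultiple b = Σ ℕ λ D → Σ ℕ λ N → (⟦ suc D ⟧ * b ≡ ⟦ suc N ⟧) ⊎ (⟦ suc D ⟧ * b ≡ - ⟦ suc N ⟧)

  clear-denominator : ∀ b → b ≢ 0ℚ → IntegralMultiple b
  clear-denominator b@(mkℚ num d-1 _) b≢0 = by-numerator num refl
    where
    denominator·b : ⟦ suc d-1 ⟧ * b ≡ ℚ.fromℚᵘ (U.mkℚᵘ num 0)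
    denominator·b = trans (cong (⟦ suc d-1 ⟧ *_) (sym (fromℚᵘ-toℚᵘ b)))
      (trans (fromℚᵘ-homo-* (U.mkℚᵘ (ℤ.+ suc d-1) 0) (U.mkℚᵘ num d-1))
        (fromℚᵘ-cong {U.mkℚᵘ (ℤ.+ suc d-1) 0 U.* U.mkℚᵘ num d-1} {U.mkℚᵘ num 0} (U.*≡* eq)))
      where
      eq : (ℤ.+ suc d-1 ℤ.* num) ℤ.* ℤ.+ 1 ≡ num ℤ.* ℤ.+ (1 ℕ.* suc d-1)
      eq = trans (ℤP.*-identityʳ _) (trans (ℤP.*-comm (ℤ.+ suc d-1) num)
             (cong (λ z → num ℤ.* ℤ.+ z) (sym (ℕP.*-identityˡ (suc d-1)))))
    denominator·b≡ : ∀ z → z ≡ num → ⟦ suc d-1 ⟧ * b ≡ ℚ.fromℚᵘ (U.mkℚᵘ z 0)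
    denominator·b≡ z e = trans denominator·b (cong (λ z → ℚ.fromℚᵘ (U.mkℚᵘ z 0)) (sym e))
    by-numerator : ∀ z → z ≡ num → IntegralMultiple b
    by-numerator (ℤ.+ zero)    e = ⊥-elim (b≢0 (*-cancelˡ-≢0 (⟦suc⟧≢0 d-1)
                                     (trans (denominator·b≡ _ e) (sym (*-zeroʳ ⟦ suc d-1 ⟧)))))
    by-numerator (ℤ.+ suc N)   e = d-1 , N , inj₁ (denominator·b≡ _ e)
    by-numerator (ℤ.-[1+ N ])  e = d-1 , N , inj₂ (denominator·b≡ _ e)

  IsMultiple : ℚ → ℚ → Set
  IsMultiple d b = Σ ℕ λ k → (d ≡ ⟦ suc k ⟧ * b) ⊎ (d ≡ ⟦ suc k ⟧ * (- b))

  multiple-of-integral : ∀ b D N M → (⟦ suc D ⟧ * b ≡ ⟦ suc N ⟧) ⊎ (⟦ suc D ⟧ * b ≡ - ⟦ suc N ⟧) →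
    IsMultiple (⟦ suc N ⟧ * ⟦ suc M ⟧) b
  multiple-of-integral b D N M s = M ℕ.+ D ℕ.* suc M , by-sign s
    where
    DM·b : ⟦ suc D ℕ.* suc M ⟧ * b ≡ ⟦ suc M ⟧ * (⟦ suc D ⟧ * b)
    DM·b = trans (cong (_* b) (⟦*⟧ (suc D) (suc M))) (solve 3 (λ x y b → x :* y :* b := y :* (x :* b)) refl ⟦ suc D ⟧ ⟦ suc M ⟧ b)
    by-sign : (⟦ suc D ⟧ * b ≡ ⟦ suc N ⟧) ⊎ (⟦ suc D ⟧ * b ≡ - ⟦ suc N ⟧) →
      (⟦ suc N ⟧ * ⟦ suc M ⟧ ≡ ⟦ suc D ℕ.* suc M ⟧ * b) ⊎ (⟦ suc N ⟧ * ⟦ suc M ⟧ ≡ ⟦ suc D ℕ.* suc M ⟧ * (- b))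
    by-sign (inj₁ p) = inj₁ (sym (trans DM·b (trans (cong (⟦ suc M ⟧ *_) p) (*-comm ⟦ suc M ⟧ ⟦ suc N ⟧))))
    by-sign (inj₂ p) = inj₂ (sym (trans (solve 2 (λ k b → k :* (:- b) := :- (k :* b)) refl ⟦ suc D ℕ.* suc M ⟧ b)
      (trans (cong -_ (trans DM·b (cong (⟦ suc M ⟧ *_) p)))
        (solve 2 (λ m n → :- (m :* :- n) := n :* m) refl ⟦ suc M ⟧ ⟦ suc N ⟧))))

  common-multiple : ∀ b b' → b ≢ 0ℚ → b' ≢ 0ℚ → Σ ℚ λ d → d ≢ 0ℚ × IsMultiple d b × IsMultiple d b'
  common-multiple b b' b≢0 b'≢0 with clear-denominator b b≢0 | clear-denominator b' b'≢0
  ... | D , N , s | D' , N' , s' = ⟦ suc N ⟧ * ⟦ suc N' ⟧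
    , (λ p → ⟦suc⟧≢0 (N' ℕ.+ N ℕ.* suc N') (trans (⟦*⟧ (suc N) (suc N')) p))
    , multiple-of-integral b D N N' s
    , subst (λ z → IsMultiple z b') (*-comm ⟦ suc N' ⟧ ⟦ suc N ⟧) (multiple-of-integral b' D' N' N s')

module Span (Gen : Set) (ev : Gen → PS) where
  open import Data.Rational using (_+_)
  open import Data.Rational.Properties using (+-identityˡ; +-identityʳ; +-assoc)
  open import Data.Product using (Σ; _,_)
  open import Data.List using (List; []; _∷_; _++_)
  open import Relation.Binary.PropositionalEquality
  open PowerSeries

  -- The ℚ-span of a family ev of power series, with scalars absorbed into
  -- the generators: F is in the span iff it is a finite sum of ev t's.
  sumEv : List Gen → PS
  sumEv []       = zeroPS
  sumEv (t ∷ ts) = ev t ⊕ sumEv ts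

  InSpan : PS → Set
  InSpan F = Σ (List Gen) λ ts → F ≐ sumEv ts

  InSpan-zero : InSpan zeroPS
  InSpan-zero = [] , ≐-refl

  InSpan-ev : ∀ t → InSpan (ev t)
  InSpan-ev t = t ∷ [] , λ n → sym (+-identityʳ _)

  InSpan-cong : ∀ {F G} → F ≐ G → InSpan F → InSpan G
  InSpan-cong p (ts , q) = ts , λ n → trans (sym (p n)) (q n)

  sumEv-++ : ∀ ts us → sumEv (ts ++ us) ≐ sumEv ts ⊕ sumEv us
  sumEv-++ []       us n = sym (+-identityˡ _)
  sumEv-++ (t ∷ ts) us n = trans (cong (ev t n +_) (sumEv-++ ts us n)) (sym (+-assoc (ev t n) _ _))

  InSpan-⊕ : ∀ {F G} → InSpan F → InSpan G → InSpan (F ⊕ G)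
  InSpan-⊕ (ts , p) (us , q) = ts ++ us , λ n → trans (cong₂ _+_ (p n) (q n)) (sym (sumEv-++ ts us n))

  InSpan-elim : (Q : PS → Set) → (∀ {F G} → F ≐ G → Q F → Q G) → Q zeroPS →
                (∀ {F G} → Q F → Q G → Q (F ⊕ G)) → (∀ t → Q (ev t)) → ∀ {F} → InSpan F → Q F
  InSpan-elim Q Q-cong Q-zero Q-⊕ Q-ev (ts , p) = Q-cong (≐-sym p) (sums ts)
    where
    sums : ∀ ts → Q (sumEv ts)
    sums []       = Q-zero
    sums (t ∷ ts) = Q-⊕ (Q-ev t) (sums ts)

  InSpan-map : (f : PS → PS) → (∀ {F G} → F ≐ G → f F ≐ f G) → f zeroPS ≐ zeroPS →
               (∀ F G → f (F ⊕ G) ≐ f F ⊕ f G) → (∀ t → InSpan (f (ev t))) → ∀ {F} → InSpan F → InSpan (f F)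
  InSpan-map f f-cong f-zero f-⊕ f-ev = InSpan-elim (λ F → InSpan (f F))
    (λ p q → InSpan-cong (f-cong p) q) (InSpan-cong (≐-sym f-zero) InSpan-zero)
    (λ {F} {G} q₁ q₂ → InSpan-cong (≐-sym (f-⊕ F G)) (InSpan-⊕ q₁ q₂)) f-ev

  InSpan-conv : (∀ t u → InSpan (conv (ev t) (ev u))) → ∀ {F G} → InSpan F → InSpan G → InSpan (conv F G)
  InSpan-conv gen-conv {F} {G} iF iG = InSpan-elim (λ F → ∀ {G} → InSpan G → InSpan (conv F G))
    (λ p q iG → InSpan-cong (conv-cong p ≐-refl) (q iG))
    (λ {G} iG → InSpan-cong (≐-sym (conv-zeroˡ G)) InSpan-zero)
    (λ {F₁} {F₂} q₁ q₂ {G} iG → InSpan-cong (≐-sym (conv-distˡ F₁ F₂ G)) (InSpan-⊕ (q₁ iG) (q₂ iG)))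
    (λ t {G} iG → InSpan-elim (λ G → InSpan (conv (ev t) G))
       (λ p q → InSpan-cong (conv-cong ≐-refl p) q)
       (InSpan-cong (≐-sym (conv-zeroʳ (ev t))) InSpan-zero)
       (λ {G₁} {G₂} q₁ q₂ → InSpan-cong (≐-sym (conv-distʳ (ev t) G₁ G₂)) (InSpan-⊕ q₁ q₂))
       (gen-conv t) iG)
    iF iG

module BernoulliSpan where
  open import Data.Nat as ℕ using (ℕ; zero; suc)
  import Data.Integer as ℤ
  open import Data.Rational as ℚ using (ℚ; 0ℚ; 1ℚ; _+_; _*_; -_)
  open import Data.Rational.Properties
  open import Algebra.Properties.Group +-0-group using (⁻¹-involutive)
  open import Data.Product using (Σ; _,_; _×_)
  open import Data.Sum using (inj₁; inj₂)
  open import Relation.Binary.PropositionalEquality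
  open Numerals
  open PowerSeries
  open Exponential
  open Bernoulli
  open CommonMultiple

  genPS : ℕ → ℚ → ℚ → PS
  genPS n a b = powPS (𝐁 b) n *PS expPS a

  genPS-conv : ∀ n a n' a' b → conv (genPS n a b) (genPS n' a' b) ≐ genPS (n ℕ.+ n') (a + a') b
  genPS-conv n a n' a' b i = begin
    conv (genPS n a b) (genPS n' a' b) i                  ≡⟨ conv-cong (*PS≐conv _ _) (*PS≐conv _ _) i ⟩
    conv (conv (Bⁿ n) (expPS a)) (conv (Bⁿ n') (expPS a')) i  ≡⟨ conv-interchange _ _ _ _ i ⟩
    conv (conv (Bⁿ n) (Bⁿ n')) (conv (expPS a) (expPS a')) i  ≡⟨ conv-cong (≐-sym (powPS-+ _ n n')) (expPS-+ a a') i ⟩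
    conv (Bⁿ (n ℕ.+ n')) (expPS (a + a')) i               ≡⟨ sym (*PS≐conv _ _ i) ⟩
    genPS (n ℕ.+ n') (a + a') b i                         ∎
    where
    open ≡-Reasoning
    Bⁿ = powPS (𝐁 b)

  term : ℚ → ℕ → ℕ → ℚ → ℚ → PS
  term c j n a b = c ⊙ shiftBy j (genPS n a b)

  term-conv : ∀ c j n a b c' j' n' a' b' →
    conv (term c j n a b) (term c' j' n' a' b') ≐ (c * c') ⊙ shiftBy (j ℕ.+ j') (conv (genPS n a b) (genPS n' a' b'))
  term-conv c j n a b c' j' n' a' b' i = begin
    conv (c ⊙ shiftBy j X) (c' ⊙ shiftBy j' Y) i       ≡⟨ conv-scaleˡ c _ _ i ⟩
    c * conv (shiftBy j X) (c' ⊙ shiftBy j' Y) i       ≡⟨ cong (c *_) (conv-scaleʳ c' _ _ i) ⟩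
    c * (c' * conv (shiftBy j X) (shiftBy j' Y) i)     ≡⟨ sym (*-assoc c c' _) ⟩
    (c * c') * conv (shiftBy j X) (shiftBy j' Y) i     ≡⟨ cong ((c * c') *_) shifts ⟩
    (c * c') * shiftBy (j ℕ.+ j') (conv X Y) i         ∎
    where
    open ≡-Reasoning
    X = genPS n a b
    Y = genPS n' a' b'
    shifts : conv (shiftBy j X) (shiftBy j' Y) i ≡ shiftBy (j ℕ.+ j') (conv X Y) i
    shifts = trans (conv-shiftByˡ j X (shiftBy j' Y) i)
      (trans (shiftBy-cong j (conv-shiftByʳ j' X Y) i) (shiftBy-+ j j' (conv X Y) i))

  shiftBy-term : ∀ i c j n a b → term c (i ℕ.+ j) n a b ≐ shiftBy i (term c j n a b)
  shiftBy-term i c j n a b k = sym (trans (shiftBy-scale i c _ k) (cong (c *_) (shiftBy-+ i j _ k)))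

  FixedTerm : Set
  FixedTerm = ℚ × ℕ × ℕ × ℚ

  fixedTerm : ℚ → FixedTerm → PS
  fixedTerm d (c , j , n , a) = term c j n a d

  module FixedScale (d : ℚ) where
    open Span FixedTerm (fixedTerm d) public

    -- Closed under products: same-scale generators multiply to a generator.
    InSpan-product : ∀ {F G} → InSpan F → InSpan G → InSpan (conv F G)
    InSpan-product = InSpan-conv λ { (c , j , n , a) (c' , j' , n' , a') →
      InSpan-cong (λ i → sym (trans (term-conv c j n a d c' j' n' a' d i)
                                    (cong ((c * c') *_) (shiftBy-cong (j ℕ.+ j') (genPS-conv n a n' a' d) i))))
        (InSpan-ev (c * c' , j ℕ.+ j' , n ℕ.+ n' , a + a')) }

    InSpan-scale : ∀ c {F} → InSpan F → InSpan (c ⊙ F)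
    InSpan-scale c = InSpan-map (c ⊙_) (λ p n → cong (c *_) (p n)) (λ n → *-zeroʳ c)
      (λ F G n → *-distribˡ-+ c (F n) (G n))
      λ { (c' , j , n , a) → InSpan-cong (λ i → *-assoc c c' _) (InSpan-ev (c * c' , j , n , a)) }

    InSpan-shiftBy : ∀ i {F} → InSpan F → InSpan (shiftBy i F)
    InSpan-shiftBy i = InSpan-map (shiftBy i) (shiftBy-cong i) (shiftBy-zero i) (shiftBy-⊕ i)
      λ { (c , j , n , a) → InSpan-cong (shiftBy-term i c j n a d) (InSpan-ev (c , i ℕ.+ j , n , a)) }

    InSpan-exp : ∀ a → InSpan (expPS a)
    InSpan-exp a = InSpan-cong (λ i → trans (*-identityˡ _) (trans (*PS≐conv onePS (expPS a) i) (conv-oneˡ (expPS a) i)))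
      (InSpan-ev (1ℚ , 0 , 0 , a))

    InSpan-one : InSpan onePS
    InSpan-one = InSpan-cong expPS-zero (InSpan-exp 0ℚ)

    InSpan-pow : ∀ {f} n → InSpan f → InSpan (powPS f n)
    InSpan-pow zero    _  = InSpan-one
    InSpan-pow {f} (suc n) iF = InSpan-cong (≐-sym (*PS≐conv f _)) (InSpan-product iF (InSpan-pow n iF))

    InSpan-𝐁 : InSpan (𝐁 d)
    InSpan-𝐁 = InSpan-cong 𝐁¹e⁰≐𝐁 (InSpan-ev (1ℚ , 0 , 1 , 0ℚ))
      where
      𝐁¹e⁰≐𝐁 : term 1ℚ 0 1 0ℚ d ≐ 𝐁 d
      𝐁¹e⁰≐𝐁 i = trans (*-identityˡ _) (trans (*PS≐conv _ (expPS 0ℚ) i)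
        (trans (conv-cong (λ k → trans (*PS≐conv _ onePS k) (conv-oneʳ (𝐁 d) k)) expPS-zero i) (conv-oneʳ (𝐁 d) i)))

    InSpan-geomExp : ∀ c k → InSpan (geomExp c k)
    InSpan-geomExp c zero    = InSpan-zero
    InSpan-geomExp c (suc k) = InSpan-⊕ (InSpan-geomExp c k) (InSpan-exp _)

    -- By the multiplication formula, 𝐁(bT) lies in the span when d = k b, k ≥ 1 …
    InSpan-𝐁-divisor : ∀ b k → b ≢ 0ℚ → d ≡ ⟦ suc k ⟧ * b → InSpan (𝐁 b)
    InSpan-𝐁-divisor b k b≢0 d≡kb = InSpan-cong (≐-sym (𝐁-multiplication b k b≢0))
      (InSpan-scale (ℤ.+ 1 ℚ./ suc k) (InSpan-product (subst (λ z → InSpan (𝐁 z)) d≡kb InSpan-𝐁) (InSpan-geomExp b (suc k))))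

    -- … and, by the reflection formula, also when d = -k b.
    InSpan-𝐁-multiple : ∀ b → b ≢ 0ℚ → IsMultiple d b → InSpan (𝐁 b)
    InSpan-𝐁-multiple b b≢0 (k , inj₁ d≡kb)  = InSpan-𝐁-divisor b k b≢0 d≡kb
    InSpan-𝐁-multiple b b≢0 (k , inj₂ d≡-kb) = InSpan-cong reflect
      (InSpan-product (InSpan-𝐁-divisor (- b) k -b≢0 d≡-kb) (InSpan-exp (- b)))
      where
      -[-b]≡b : - (- b) ≡ b
      -[-b]≡b = ⁻¹-involutive b
      -b≢0 : - b ≢ 0ℚ
      -b≢0 p = b≢0 (trans (sym -[-b]≡b) (cong -_ p))
      reflect : conv (𝐁 (- b)) (expPS (- b)) ≐ 𝐁 b
      reflect i = trans (sym (𝐁-reflection (- b) -b≢0 i)) (cong (λ z → 𝐁 z i) -[-b]≡b)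

    InSpan-genPS : ∀ b n a → b ≢ 0ℚ → IsMultiple d b → InSpan (genPS n a b)
    InSpan-genPS b n a b≢0 d∣b = InSpan-cong (≐-sym (*PS≐conv _ _))
      (InSpan-product (InSpan-pow n (InSpan-𝐁-multiple b b≢0 d∣b)) (InSpan-exp a))

  BTerm : Set
  BTerm = Σ (ℚ × ℕ × ℕ × ℚ × ℚ) λ { (c , j , n , a , b) → b ≢ 0ℚ }

  bTerm : BTerm → PS
  bTerm ((c , j , n , a , b) , _) = term c j n a b

  module Full = Span BTerm bTerm
  open Full public using () renaming (InSpan to In𝔖)

  fixed⊆full : ∀ d → d ≢ 0ℚ → ∀ {F} → FixedScale.InSpan d F → In𝔖 F
  fixed⊆full d d≢0 = FixedScale.InSpan-elim d In𝔖 Full.InSpan-cong Full.InSpan-zero Full.InSpan-⊕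
    λ { (c , j , n , a) → Full.InSpan-ev ((c , j , n , a , d) , d≢0) }

  -- The product of two terms lies in the fixed-scale span of a common
  -- multiple of their scales, hence in the full span.
  In𝔖-conv : ∀ {F G} → In𝔖 F → In𝔖 G → In𝔖 (conv F G)
  In𝔖-conv = Full.InSpan-conv λ { ((c , j , n , a , b) , b≢0) ((c' , j' , n' , a' , b') , b'≢0) →
    terms-conv c j n a b c' j' n' a' b' b≢0 b'≢0 }
    where
    terms-conv : ∀ c j n a b c' j' n' a' b' → b ≢ 0ℚ → b' ≢ 0ℚ → In𝔖 (conv (term c j n a b) (term c' j' n' a' b'))
    terms-conv c j n a b c' j' n' a' b' b≢0 b'≢0 with common-multiple b b' b≢0 b'≢0
    ... | d , d≢0 , d∣b , d∣b' = Full.InSpan-cong (≐-sym (term-conv c j n a b c' j' n' a' b'))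
      (fixed⊆full d d≢0 (FixedScale.InSpan-scale d (c * c') (FixedScale.InSpan-shiftBy d (j ℕ.+ j')
        (FixedScale.InSpan-product d (FixedScale.InSpan-genPS d b n a b≢0 d∣b) (FixedScale.InSpan-genPS d b' n' a' b'≢0 d∣b')))))

  In𝔖-shiftBy : ∀ i {F} → In𝔖 F → In𝔖 (shiftBy i F)
  In𝔖-shiftBy i = Full.InSpan-map (shiftBy i) (shiftBy-cong i) (shiftBy-zero i) (shiftBy-⊕ i)
    λ { ((c , j , n , a , b) , b≢0) → Full.InSpan-cong (shiftBy-term i c j n a b) (Full.InSpan-ev ((c , i ℕ.+ j , n , a , b) , b≢0)) }

module LaurentSeries where
  open import Data.Nat as ℕ using (ℕ)
  import Data.Nat.Properties as ℕP
  open import Data.Integer as ℤ using (ℤ; +_; -[1+_])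
  import Data.Integer.Properties as ℤP
  open import Data.Integer.Solver using (module +-*-Solver)
  open import Data.Rational using (ℚ; 0ℚ; _+_; _*_; -_)
  open import Data.Rational.Properties
  open import Data.Product using (Σ; _,_)
  open import Data.Sum using (_⊎_; inj₁; inj₂)
  open import Data.Empty using (⊥-elim)
  open import Relation.Nullary using (yes; no)
  open import Relation.Binary.PropositionalEquality
  open PowerSeries
  open +-*-Solver using (solve; _:+_; _:-_; _:=_)

  k≡v+[k-v] : ∀ k v → k ≡ v ℤ.+ (k ℤ.- v)
  k≡v+[k-v] = solve 2 (λ k v → k := v :+ (k :- v)) refl

  at-or-below : ∀ v k → (Σ ℕ λ i → k ≡ v ℤ.+ + i) ⊎ (k ℤ.< v)
  at-or-below v k with k ℤ.- v in eq
  ... | + i      = inj₁ (i , trans (k≡v+[k-v] k v) (cong (ℤ._+_ v) eq))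
  ... | -[1+ t ] = inj₂ (subst₂ ℤ._<_ (sym (trans (k≡v+[k-v] k v) (cong (ℤ._+_ v) eq)))
                                      (ℤP.+-identityʳ v) (ℤP.+-monoʳ-< v (ℤ.-<+ {t} {0})))

  ≤-split : ∀ {M a} → M ℤ.≤ a → Σ ℕ λ j → a ≡ M ℤ.+ + j
  ≤-split {M} {a} M≤a with at-or-below M a
  ... | inj₁ p   = p
  ... | inj₂ a<M = ⊥-elim (ℤP.<⇒≱ a<M M≤a)

  coefL-at : ∀ v f i → coefL (laurent v f) (v ℤ.+ + i) ≡ f i
  coefL-at v f i rewrite solve 2 (λ v i → v :+ i :- v := i) refl v (+ i) = refl

  coefL-at′ : ∀ v f k i → k ≡ v ℤ.+ + i → coefL (laurent v f) k ≡ f i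
  coefL-at′ v f k i refl = coefL-at v f i

  coefL-below : ∀ v f k → k ℤ.< v → coefL (laurent v f) k ≡ 0ℚ
  coefL-below v f k k<v with k ℤ.- v in eq
  ... | + i      = ⊥-elim (ℤP.<⇒≱ k<v (subst (v ℤ.≤_) (sym (trans (k≡v+[k-v] k v) (cong (ℤ._+_ v) eq))) (ℤP.i≤i+j v (+ i))))
  ... | -[1+ _ ] = refl

  ≈L-sym : ∀ {x y} → x ≈L y → y ≈L x
  ≈L-sym p k = sym (p k)

  ≈L-trans : ∀ {x y z} → x ≈L y → y ≈L z → x ≈L z
  ≈L-trans p q k = trans (p k) (q k)

  -- Coefficientwise operations on series with a common valuation act on
  -- coefficients, provided they fix the zero coefficients below v.
  coefL-map₂ : (φ : ℚ → ℚ → ℚ) → φ 0ℚ 0ℚ ≡ 0ℚ → ∀ v f g k →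
    coefL (laurent v (λ i → φ (f i) (g i))) k ≡ φ (coefL (laurent v f) k) (coefL (laurent v g) k)
  coefL-map₂ φ φ00 v f g k with at-or-below v k
  ... | inj₁ (i , e) = trans (coefL-at′ v _ k i e) (sym (cong₂ φ (coefL-at′ v f k i e) (coefL-at′ v g k i e)))
  ... | inj₂ k<v     = trans (coefL-below v _ k k<v) (sym (trans (cong₂ φ (coefL-below v f k k<v) (coefL-below v g k k<v)) φ00))

  laurent-zero : ∀ v k → coefL (laurent v zeroPS) k ≡ 0ℚ
  laurent-zero v = coefL-map₂ (λ _ _ → 0ℚ) refl v zeroPS zeroPS

  laurent-⊕ : ∀ v f g k → coefL (laurent v (f ⊕ g)) k ≡ coefL (laurent v f) k + coefL (laurent v g) k
  laurent-⊕ = coefL-map₂ _+_ (+-identityʳ 0ℚ)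

  coefL-· : ∀ c x k → coefL (c ·L x) k ≡ c * coefL x k
  coefL-· c (laurent v f) = coefL-map₂ (λ a _ → c * a) (*-zeroʳ c) v f f

  coefL-neg : ∀ x k → coefL (-L x) k ≡ - coefL x k
  coefL-neg (laurent v f) = coefL-map₂ (λ a _ → - a) refl v f f

  coefL-+ : ∀ x y k → coefL (x +L y) k ≡ coefL x k + coefL y k
  coefL-+ x@(laurent v f) y@(laurent w g) k with at-or-below (v ℤ.⊓ w) k
  ... | inj₁ (i , e) = trans (coefL-at′ (v ℤ.⊓ w) _ k i e) (cong₂ (λ a b → coefL x a + coefL y b) (sym e) (sym e))
  ... | inj₂ k<m     = trans (coefL-below _ _ k k<m) (sym (trans
    (cong₂ _+_ (coefL-below v f k (ℤP.<-≤-trans k<m (ℤP.i⊓j≤i v w))) (coefL-below w g k (ℤP.<-≤-trans k<m (ℤP.i⊓j≤j v w))))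
    (+-identityʳ 0ℚ)))

  laurent-cong : ∀ v {f g} → f ≐ g → laurent v f ≈L laurent v g
  laurent-cong v {f} {g} p k with at-or-below v k
  ... | inj₁ (i , e) = trans (coefL-at′ v f k i e) (trans (p i) (sym (coefL-at′ v g k i e)))
  ... | inj₂ k<v     = trans (coefL-below v f k k<v) (sym (coefL-below v g k k<v))

  laurent-injective : ∀ v {f g} → laurent v f ≈L laurent v g → f ≐ g
  laurent-injective v {f} {g} p i = trans (sym (coefL-at v f i)) (trans (p (v ℤ.+ + i)) (coefL-at v g i))

  lower : ∀ L j f → laurent (L ℤ.+ + j) f ≈L laurent L (shiftBy j f)
  lower L j f k with at-or-below L k
  ... | inj₂ k<L = trans (coefL-below _ f k (ℤP.<-≤-trans k<L (ℤP.i≤i+j L (+ j)))) (sym (coefL-below L _ k k<L))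
  ... | inj₁ (i , e) with j ℕ.≤? i
  ...   | yes j≤i = trans (coefL-at′ (L ℤ.+ + j) f k (i ℕ.∸ j) k≡L+j+[i-j])
                      (trans (sym (shiftBy-at j f (i ℕ.∸ j)))
                        (trans (cong (shiftBy j f) (ℕP.m+[n∸m]≡n j≤i)) (sym (coefL-at′ L _ k i e))))
    where
    k≡L+j+[i-j] : k ≡ (L ℤ.+ + j) ℤ.+ + (i ℕ.∸ j)
    k≡L+j+[i-j] = trans e (trans (cong (λ z → L ℤ.+ + z) (sym (ℕP.m+[n∸m]≡n j≤i)))
      (trans (cong (ℤ._+_ L) (ℤP.pos-+ j (i ℕ.∸ j))) (sym (ℤP.+-assoc L (+ j) (+ (i ℕ.∸ j))))))
  ...   | no j≰i = trans (coefL-below _ f k k<L+j) (sym (trans (coefL-at′ L _ k i e) (shiftBy-below j f i (ℕP.≰⇒> j≰i))))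
    where
    k<L+j : k ℤ.< L ℤ.+ + j
    k<L+j = subst (ℤ._< L ℤ.+ + j) (sym e) (ℤP.+-monoʳ-< L (ℤ.+<+ (ℕP.≰⇒> j≰i)))

  lower-to : ∀ {a} L {j} f → a ≡ L ℤ.+ + j → laurent a f ≈L laurent L (shiftBy j f)
  lower-to L {j} f refl = lower L j f

  lower-*L : ∀ {v w} L₁ L₂ j k f g → v ≡ L₁ ℤ.+ + j → w ≡ L₂ ℤ.+ + k →
    laurent v f *L laurent w g ≈L laurent (L₁ ℤ.+ L₂) (conv (shiftBy j f) (shiftBy k g))
  lower-*L L₁ L₂ j k f g refl refl = ≈L-trans (lower-to (L₁ ℤ.+ L₂) (f *PS g) valuation) (laurent-cong (L₁ ℤ.+ L₂) shifted)
    where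
    open ≡-Reasoning
    valuation : (L₁ ℤ.+ + j) ℤ.+ (L₂ ℤ.+ + k) ≡ (L₁ ℤ.+ L₂) ℤ.+ + (j ℕ.+ k)
    valuation = trans (solve 4 (λ a b x y → (a :+ x) :+ (b :+ y) := (a :+ b) :+ (x :+ y)) refl L₁ L₂ (+ j) (+ k))
                      (cong (ℤ._+_ (L₁ ℤ.+ L₂)) (sym (ℤP.pos-+ j k)))
    shifted : shiftBy (j ℕ.+ k) (f *PS g) ≐ conv (shiftBy j f) (shiftBy k g)
    shifted i = begin
      shiftBy (j ℕ.+ k) (f *PS g) i        ≡⟨ shiftBy-cong (j ℕ.+ k) (*PS≐conv f g) i ⟩
      shiftBy (j ℕ.+ k) (conv f g) i       ≡⟨ sym (shiftBy-+ j k (conv f g) i) ⟩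
      shiftBy j (shiftBy k (conv f g)) i   ≡⟨ sym (shiftBy-cong j (conv-shiftByʳ k f g) i) ⟩
      shiftBy j (conv f (shiftBy k g)) i   ≡⟨ sym (conv-shiftByˡ j f (shiftBy k g) i) ⟩
      conv (shiftBy j f) (shiftBy k g) i   ∎

  -- Equal Laurent series T^v f = T^w g agree as power series once both are
  -- written with the valuation v ⊓ w.
  record CommonLowering (v w : ℤ) (f g : PS) : Set where
    field
      j k     : ℕ
      v≡      : v ≡ (v ℤ.⊓ w) ℤ.+ + j
      w≡      : w ≡ (v ℤ.⊓ w) ℤ.+ + k
      shifted : shiftBy j f ≐ shiftBy k g

  common-lowering : ∀ {v w f g} → laurent v f ≈L laurent w g → CommonLowering v w f g
  common-lowering {v} {w} {f} {g} p with ≤-split (ℤP.i⊓j≤i v w) | ≤-split (ℤP.i⊓j≤j v w)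
  ... | j , v≡ | k , w≡ = record { j = j ; k = k ; v≡ = v≡ ; w≡ = w≡
    ; shifted = laurent-injective (v ℤ.⊓ w) (≈L-trans (≈L-sym (lower-to _ f v≡)) (≈L-trans p (lower-to _ g w≡))) }

  *L-cong : ∀ {x x' y y'} → x ≈L x' → y ≈L y' → x *L y ≈L x' *L y'
  *L-cong {laurent v f} {laurent v' f'} {laurent w g} {laurent w' g'} p q =
    ≈L-trans (lower-*L (v ℤ.⊓ v') (w ℤ.⊓ w') (j P) (j Q) f g (v≡ P) (v≡ Q))
      (≈L-trans (laurent-cong _ (conv-cong (shifted P) (shifted Q)))
        (≈L-sym (lower-*L (v ℤ.⊓ v') (w ℤ.⊓ w') (k P) (k Q) f' g' (w≡ P) (w≡ Q))))
    where
    open CommonLowering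
    P = common-lowering p
    Q = common-lowering q

module Closure where
  open import Data.Integer as ℤ using (ℤ)
  import Data.Integer.Properties as ℤP
  open import Data.Rational using (1ℚ; _+_; _*_; -_)
  open import Data.Rational.Properties
  open import Data.Product using (Σ; _,_; _×_)
  open import Data.List using (List; []; _∷_; _++_; map)
  open import Data.List.Relation.Unary.All using (All; []; _∷_)
  open import Data.List.Relation.Unary.All.Properties using (++⁺; map⁺)
  open import Relation.Binary.PropositionalEquality
  open PowerSeries
  open BernoulliSpan
  open LaurentSeries

  In𝔅-resp : ∀ {x y} → x ≈L y → In𝔅 y → In𝔅 x
  In𝔅-resp p (ts , al , q) = ts , al , ≈L-trans p q

  record 𝔖-Rep (x : Laurent) : Set where
    constructor 𝔖-rep
    field
      M      : ℤ
      F      : PS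
      F∈𝔖    : In𝔖 F
      x≈T^MF : x ≈L laurent M F

  +L-rep : ∀ {x y} → 𝔖-Rep x → 𝔖-Rep y → 𝔖-Rep (x +L y)
  +L-rep {x} {y} (𝔖-rep M F F∈𝔖 p) (𝔖-rep N G G∈𝔖 q) with ≤-split (ℤP.i⊓j≤i M N) | ≤-split (ℤP.i⊓j≤j M N)
  ... | j , M≡ | k , N≡ = 𝔖-rep L (shiftBy j F ⊕ shiftBy k G)
    (Full.InSpan-⊕ (In𝔖-shiftBy j F∈𝔖) (In𝔖-shiftBy k G∈𝔖))
    λ i → trans (coefL-+ x y i)
      (trans (cong₂ _+_ (trans (p i) (lower-to L F M≡ i)) (trans (q i) (lower-to L G N≡ i)))
        (sym (laurent-⊕ L (shiftBy j F) (shiftBy k G) i)))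
    where L = M ℤ.⊓ N

  linComb-rep : ∀ ts → All bNonZero ts → 𝔖-Rep (linComb ts)
  linComb-rep []                       []          = 𝔖-rep (ℤ.+ 0) zeroPS Full.InSpan-zero (λ k → refl)
  linComb-rep ((c , m , n , a , b) ∷ ts) (b≢0 ∷ al) = +L-rep
    (𝔖-rep m (term c 0 n a b) (Full.InSpan-ev ((c , 0 , n , a , b) , b≢0)) (λ k → refl))
    (linComb-rep ts al)

  In𝔅⇒rep : ∀ {x} → In𝔅 x → 𝔖-Rep x
  In𝔅⇒rep (ts , al , p) with linComb-rep ts al
  ... | 𝔖-rep M F F∈𝔖 q = 𝔖-rep M F F∈𝔖 (≈L-trans p q)

  -- Conversely, T^M F lies in 𝔅 for F ∈ 𝔖: each term c T^j 𝐁^n(bT) e^{aT}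
  -- becomes the generator with exponent M + j.
  sumEv-linComb : ∀ M ts → Σ (List Term) λ us → All bNonZero us × (linComb us ≈L laurent M (Full.sumEv ts))
  sumEv-linComb M [] = [] , [] , λ k → trans (laurent-zero (ℤ.+ 0) k) (sym (laurent-zero M k))
  sumEv-linComb M (((c , j , n , a , b) , b≢0) ∷ ts) with sumEv-linComb M ts
  ... | us , al , q = (c , M ℤ.+ ℤ.+ j , n , a , b) ∷ us , b≢0 ∷ al ,
    λ k → trans (coefL-+ (termL (c , M ℤ.+ ℤ.+ j , n , a , b)) (linComb us) k)
            (trans (cong₂ _+_ (trans (lower M j (c ⊙ genPS n a b) k) (laurent-cong M (shiftBy-scale j c (genPS n a b)) k)) (q k))
              (sym (laurent-⊕ M _ _ k)))

  rep⇒In𝔅 : ∀ M {F} → In𝔖 F → In𝔅 (laurent M F)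
  rep⇒In𝔅 M (ts , p) with sumEv-linComb M ts
  ... | us , al , q = us , al , ≈L-trans (laurent-cong M p) (≈L-sym q)

  linComb-++ : ∀ ts us k → coefL (linComb (ts ++ us)) k ≡ coefL (linComb ts) k + coefL (linComb us) k
  linComb-++ [] us k = sym (trans (cong (_+ coefL (linComb us) k) (laurent-zero (ℤ.+ 0) k)) (+-identityˡ _))
  linComb-++ (t ∷ ts) us k = begin
    coefL (termL t +L linComb (ts ++ us)) k                             ≡⟨ coefL-+ (termL t) _ k ⟩
    coefL (termL t) k + coefL (linComb (ts ++ us)) k                    ≡⟨ cong (coefL (termL t) k +_) (linComb-++ ts us k) ⟩
    coefL (termL t) k + (coefL (linComb ts) k + coefL (linComb us) k)   ≡⟨ sym (+-assoc (coefL (termL t) k) _ _) ⟩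
    (coefL (termL t) k + coefL (linComb ts) k) + coefL (linComb us) k   ≡⟨ cong (_+ coefL (linComb us) k) (sym (coefL-+ (termL t) (linComb ts) k)) ⟩
    coefL (termL t +L linComb ts) k + coefL (linComb us) k              ∎
    where open ≡-Reasoning

  negTerm : Term → Term
  negTerm (c , m , n , a , b) = (- c , m , n , a , b)

  linComb-neg : ∀ ts k → coefL (linComb (map negTerm ts)) k ≡ - coefL (linComb ts) k
  linComb-neg [] k = trans (laurent-zero (ℤ.+ 0) k) (sym (cong -_ (laurent-zero (ℤ.+ 0) k)))
  linComb-neg (t@(c , m , n , a , b) ∷ ts) k = begin
    coefL (termL (negTerm t) +L linComb (map negTerm ts)) k                 ≡⟨ coefL-+ (termL (negTerm t)) _ k ⟩
    coefL (termL (negTerm t)) k + coefL (linComb (map negTerm ts)) k        ≡⟨ cong₂ _+_ (coefL-· (- c) (gen m n a b) k) (linComb-neg ts k) ⟩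
    - c * coefL (gen m n a b) k + - coefL (linComb ts) k                    ≡⟨ cong (_+ - coefL (linComb ts) k) (sym (neg-distribˡ-* c _)) ⟩
    - (c * coefL (gen m n a b) k) + - coefL (linComb ts) k                  ≡⟨ sym (neg-distrib-+ (c * coefL (gen m n a b) k) _) ⟩
    - (c * coefL (gen m n a b) k + coefL (linComb ts) k)                    ≡⟨ cong (λ z → - (z + coefL (linComb ts) k)) (sym (coefL-· c (gen m n a b) k)) ⟩
    - (coefL (termL t) k + coefL (linComb ts) k)                            ≡⟨ cong -_ (sym (coefL-+ (termL t) (linComb ts) k)) ⟩
    - coefL (termL t +L linComb ts) k                                       ∎
    where open ≡-Reasoning

  In𝔅-one : In𝔅 1L
  In𝔅-one = rep⇒In𝔅 (ℤ.+ 0) (fixed⊆full 1ℚ 1≢0 (FixedScale.InSpan-one 1ℚ))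

  In𝔅-+ : ∀ x y → In𝔅 x → In𝔅 y → In𝔅 (x +L y)
  In𝔅-+ x y (ts , al , p) (us , al' , q) = ts ++ us , ++⁺ al al' ,
    λ k → trans (coefL-+ x y k) (trans (cong₂ _+_ (p k) (q k)) (sym (linComb-++ ts us k)))

  In𝔅-neg : ∀ x → In𝔅 x → In𝔅 (-L x)
  In𝔅-neg x (ts , al , p) = map negTerm ts , map⁺ al ,
    λ k → trans (coefL-neg x k) (trans (cong -_ (p k)) (sym (linComb-neg ts k)))

  -- x y = T^{M+N} F G, and F G ∈ 𝔖.
  In𝔅-* : ∀ x y → In𝔅 x → In𝔅 y → In𝔅 (x *L y)
  In𝔅-* x y x∈𝔅 y∈𝔅 with In𝔅⇒rep x∈𝔅 | In𝔅⇒rep y∈𝔅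
  ... | 𝔖-rep M F F∈𝔖 p | 𝔖-rep N G G∈𝔖 q =
    In𝔅-resp (≈L-trans (*L-cong p q) (laurent-cong (M ℤ.+ N) (*PS≐conv F G))) (rep⇒In𝔅 (M ℤ.+ N) (In𝔖-conv F∈𝔖 G∈𝔖))

proposition1 : In𝔅 1L
               × (∀ x y → In𝔅 x → In𝔅 y → In𝔅 (x +L y))
               × (∀ x → In𝔅 x → In𝔅 (-L x))
               × (∀ x y → In𝔅 x → In𝔅 y → In𝔅 (x *L y))
proposition1 = In𝔅-one , In𝔅-+ , In𝔅-neg , In𝔅-*
  where open Closure
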